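{- Let $G$ be a finite connected multigraph without loops, with vertex ordering $v_1,\ldots,v_n$ and Laplacian matrix $Q$ with respect to this ordering. Let $L$ be any real $n\times n$ matrix satisfying $QLQ=Q$ (a generalized inverse of $Q$). Then for all divisors $D_1,D_2\in\operatorname{Div}^0(G)$, the monodromy pairing satisfies \[ \langle \overline{D}_1,\overline{D}_2\rangle = [D_1]^T L\,[D_2] \pmod{\mathbb{Z}}, \] where $[D]\in\mathbb{Z}^n$ denotes the column vector $(D(v_1),\ldots,D(v_n))^T$.
   Context: The Laplacian matrix $Q=(q_{ij})$ has $q_{ii}=\deg(v_i)$ and, for $i\neq j$, $-q_{ij}$ equal to the number of edges joining $v_i$ and $v_j$. $\operatorname{Div}(G)$ is the free abelian group on $V(G)$; for $D\in\operatorname{Div}(G)$, $D(v)$ is the coefficient of $v$. $\operatorname{Div}^0(G)$ is the subgroup of divisors with $\sum_v D(v)=0$. For $f:V(G)\to\mathbb{Z}$, $\operatorname{div}(f)=\sum_v \big(\sum_{\{v,w\}\in E(G)}(f(v)-f(w))\big)(v)$ (edges counted with multiplicity); such divisors are called principal and form $\operatorname{Prin}(G)\subseteq \operatorname{Div}^0(G)$. $\operatorname{Jac}(G)=\operatorname{Div}^0(G)/\operatorname{Prin}(G)$ is a finite abelian group; $\overline{D}$ denotes the class of $D\in\operatorname{Div}^0(G)$. The monodromy pairing $\langle\cdot,\cdot\rangle:\operatorname{Jac}(G)\times\operatorname{Jac}(G)\to\mathbb{Q}/\mathbb{Z}$ is defined by choosing a nonzero integer $m_2$ and $f_2:V(G)\to\mathbb{Z}$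 with $m_2D_2=\operatorname{div}(f_2)$ and setting $\langle\overline{D}_1,\overline{D}_2\rangle=\frac{1}{m_2}\sum_{v\in V(G)}D_1(v)f_2(v)\pmod{\mathbb{Z}}$; this is independent of the choices of lifts, $m_2$, and $f_2$. -}

module Defs where

open import Level using (Level)
open import Data.Nat as ℕ using (ℕ; zero; suc)
open import Data.Fin using (Fin; zero; suc)
open import Data.Integer as ℤ using (ℤ; +_; -[1+_])
open import Data.Rational as ℚ using (ℚ)
open import Data.Product using (∃)
open import Relation.Binary.PropositionalEquality using (_≡_)
open import Relation.Nullary using (yes; no)
open import Data.Fin using (_≟_)
open import Algebra.Bundles using (CommutativeRing)

∑ℤ : ∀ {n} → (Fin n → ℤ) → ℤ
∑ℤ {zero}  f = + 0
∑ℤ {suc n} f = f zero ℤ.+ ∑ℤ (λ i → f (suc i))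

module _ {c ℓ : Level} (R : CommutativeRing c ℓ) where
  open CommutativeRing R using (Carrier; 0#; _+_)

  ∑R : ∀ {n} → (Fin n → Carrier) → Carrier
  ∑R {zero}  f = 0#
  ∑R {suc n} f = f zero + ∑R (λ i → f (suc i))

-- Finite loopless multigraphs on vertex set Fin n (ordering v_1..v_n =
-- 0..n-1), given by a symmetric edge-multiplicity matrix with zero
-- diagonal.

record Multigraph (n : ℕ) : Set where
  field
    mult      : Fin n → Fin n → ℕ
    symmetric : ∀ i j → mult i j ≡ mult j i
    loopless  : ∀ i → mult i i ≡ 0

open Multigraph public

data Reachable {n} (G : Multigraph n) : Fin n → Fin n → Set where
  here : ∀ {i} → Reachable G i i
  step : ∀ {i j k} → ℕ.NonZero (mult G i j) → Reachable G j k → Reachable G i k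

Connected : ∀ {n} → Multigraph n → Set
Connected G = ∀ i j → Reachable G i j

degree : ∀ {n} → Multigraph n → Fin n → ℤ
degree G i = ∑ℤ (λ j → + mult G i j)

laplacian : ∀ {n} → Multigraph n → Fin n → Fin n → ℤ
laplacian G i j with i ≟ j
... | yes _ = degree G i
... | no _  = ℤ.- (+ mult G i j)

Div : ℕ → Set
Div n = Fin n → ℤ

degDiv : ∀ {n} → Div n → ℤ
degDiv D = ∑ℤ D

IsDiv0 : ∀ {n} → Div n → Set
IsDiv0 D = degDiv D ≡ + 0

divf : ∀ {n} → Multigraph n → (Fin n → ℤ) → Div n
divf G f v = ∑ℤ (λ w → + mult G v w ℤ.* (f v ℤ.- f w))

_·D_ : ∀ {n} → ℤ → Div n → Div n
(m ·D D) v = m ℤ.* D v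

-- Rational number a / m for integers a, m (junk value 0 when m = 0)

_/ℤ_ : ℤ → ℤ → ℚ
a /ℤ (+ zero)  = ℚ.0ℚ
a /ℤ (+ suc m) = a ℚ./ suc m
a /ℤ -[1+ m ]  = (ℤ.- a) ℚ./ suc m

-- the representative (1/m₂) Σ_v D₁(v) f₂(v) of the monodromy pairing,
-- for a choice m₂ ≠ 0, f₂ with m₂ D₂ = div(f₂)
pairingRep : ∀ {n} → Div n → ℤ → (Fin n → ℤ) → ℚ
pairingRep D₁ m₂ f₂ = ∑ℤ (λ v → D₁ v ℤ.* f₂ v) /ℤ m₂

module Submission where

-- Proposition 3.7: the monodromy pairing is computed by any generalized
-- inverse L of the Laplacian Q (QLQ = Q), ⟨D₁,D₂⟩ = D₁ᵀ L D₂ mod ℤ; in fact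
-- the representative (1/m)·Σ D₁(v) f(v), for m D₂ = div f, equals D₁ᵀ L D₂
-- exactly.  Since G is connected, Qy = 0 forces
-- y to be constant (an energy argument over ℚ), so by the Fredholm
-- alternative (Gaussian elimination over ℚ) the degree-zero divisor D₁ equals
-- Qh for a rational vector h.  With d₂ = Q f / m and Q symmetric,
--   D₁ᵀ L D₂ = hᵀ Q L Q f / m = hᵀ Q f / m = D₁ᵀ f / m.

open import Defs
open import Level using (Level)
open import Data.Nat as ℕ using (ℕ; zero; suc)
open import Data.Fin using (Fin; zero; suc; punchIn; _≟_)
open import Data.Fin.Properties using (punchInᵢ≢i; all?; ¬∀⟶∃¬)
open import Data.Integer as ℤ using (ℤ; +_; -[1+_]; 0ℤ)
import Data.Integer.Properties as ℤP
import Data.Nat.Properties as ℕP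
open import Data.Rational as ℚ using (ℚ; 0ℚ; fromℚᵘ)
import Data.Rational
import Data.Rational.Properties as ℚP
open import Data.Rational.Unnormalised as ℚᵘ using (mkℚᵘ; *≡*)
import Data.Rational.Unnormalised.Properties as ℚᵘP
open import Data.Product using (∃; _,_; _×_; proj₁; proj₂)
open import Relation.Nullary using (¬_; yes; no)
open import Relation.Unary using (Decidable)
open import Data.Sum as Sum using (_⊎_; inj₁; inj₂)
open import Data.Empty using (⊥-elim)
open import Relation.Binary.PropositionalEquality as ≡ using (_≡_; _≢_)
open import Algebra.Bundles using (CommutativeRing)
open import Algebra.Morphism.Structures using (IsRingHomomorphism)
import Relation.Binary.Reasoning.Setoid

module LinearAlgebra {c ℓ} (R : CommutativeRing c ℓ) where
  open CommutativeRing R hiding (zero)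
  open import Algebra.Properties.Semiring.Sum semiring public
    using (sum; sum-cong-≋; ∑-distrib-+; ∑-comm; *-distribˡ-sum; *-distribʳ-sum; sum-replicate-zero; sum-remove)
  open import Algebra.Properties.Ring ring using (-‿distribˡ-*; -0#≈0#)
  open import Algebra.Properties.AbelianGroup +-abelianGroup using (⁻¹-∙-comm)
  open import Algebra.Properties.CommutativeSemigroup *-commutativeSemigroup using (x∙yz≈y∙xz)
  open import Relation.Binary.Reasoning.Setoid setoid

  Vector : ℕ → Set c
  Vector n = Fin n → Carrier

  Matrix : ℕ → ℕ → Set c
  Matrix m n = Fin m → Fin n → Carrier

  sum-cong : ∀ {n} {f g : Vector n} → (∀ i → f i ≈ g i) → sum f ≈ sum g
  sum-cong {f = f} {g} = sum-cong-≋ {x = f} {y = g}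

  ∑R≡sum : ∀ {n} (f : Vector n) → ∑R R f ≡ sum f
  ∑R≡sum {zero}  f = ≡.refl
  ∑R≡sum {suc n} f = ≡.cong (λ s → f zero + s) (∑R≡sum (λ i → f (suc i)))

  ∑R-double : ∀ {m n} (f : Matrix m n) → ∑R R (λ i → ∑R R (f i)) ≈ sum (λ i → sum (f i))
  ∑R-double f = trans (reflexive (∑R≡sum (λ i → ∑R R (f i)))) (sum-cong (λ i → reflexive (∑R≡sum (f i))))

  sum-neg : ∀ {n} (f : Vector n) → sum (λ i → - f i) ≈ - sum f
  sum-neg {zero}  f = sym -0#≈0#
  sum-neg {suc n} f = trans (+-congˡ (sum-neg (λ i → f (suc i)))) (⁻¹-∙-comm _ _)

  sum-point : ∀ {n} (i : Fin n) (f : Vector n) → (∀ j → j ≢ i → f j ≈ 0#) → sum f ≈ f i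
  sum-point {suc n} i f f≈0 = begin
    sum f                            ≈⟨ sum-remove {i = i} f ⟩
    f i + sum (λ j → f (punchIn i j)) ≈⟨ +-congˡ (sum-cong (λ j → f≈0 (punchIn i j) (punchInᵢ≢i i j))) ⟩
    f i + sum {n} (λ _ → 0#)          ≈⟨ +-congˡ (sum-replicate-zero n) ⟩
    f i + 0#                          ≈⟨ +-identityʳ (f i) ⟩
    f i                               ∎

  δ : ∀ {n} → Fin n → Vector n
  δ i j with i ≟ j
  ... | yes _ = 1#
  ... | no  _ = 0#

  infix 7 _·_
  infixr 8 _▹_
  infixl 8 _◃_

  _·_ : ∀ {n} → Vector n → Vector n → Carrier
  u · v = sum (λ i → u i * v i)

  _▹_ : ∀ {m n} → Matrix m n → Vector n → Vector m
  (A ▹ v) i = A i · v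

  _◃_ : ∀ {m n} → Vector m → Matrix m n → Vector n
  (u ◃ A) j = u · (λ i → A i j)

  Symmetric : ∀ {n} → Matrix n n → Set ℓ
  Symmetric A = ∀ i j → A i j ≈ A j i

  ·-cong : ∀ {n} {u u′ v v′ : Vector n} → (∀ i → u i ≈ u′ i) → (∀ i → v i ≈ v′ i) → u · v ≈ u′ · v′
  ·-cong u≈ v≈ = sum-cong (λ i → *-cong (u≈ i) (v≈ i))

  ·-congˡ : ∀ {n} (u : Vector n) {v v′ : Vector n} → (∀ i → v i ≈ v′ i) → u · v ≈ u · v′
  ·-congˡ u = ·-cong (λ i → refl)

  ·-comm : ∀ {n} (u v : Vector n) → u · v ≈ v · u
  ·-comm u v = sum-cong (λ i → *-comm (u i) (v i))

  ·-scaleʳ : ∀ {n} a (u v : Vector n) → u · (λ i → a * v i) ≈ a * (u · v)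
  ·-scaleʳ a u v = trans (sum-cong (λ i → x∙yz≈y∙xz (u i) a (v i))) (sym (*-distribˡ-sum a (λ i → u i * v i)))

  ·-scaleˡ : ∀ {n} a (u v : Vector n) → (λ i → a * u i) · v ≈ a * (u · v)
  ·-scaleˡ a u v = trans (sum-cong (λ i → *-assoc a (u i) (v i))) (sym (*-distribˡ-sum a (λ i → u i * v i)))

  ·-distrib-+ : ∀ {n} (u v w : Vector n) → (λ i → u i + v i) · w ≈ u · w + v · w
  ·-distrib-+ u v w = trans (sum-cong (λ i → distribʳ (w i) (u i) (v i))) (∑-distrib-+ (λ i → u i * w i) (λ i → v i * w i))

  ·-neg : ∀ {n} (u v : Vector n) → (λ i → - u i) · v ≈ - (u · v)
  ·-neg u v = trans (sum-cong (λ i → sym (-‿distribˡ-* (u i) (v i)))) (sum-neg (λ i → u i * v i))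

  ·-distrib-- : ∀ {n} (u v w : Vector n) → (λ i → u i - v i) · w ≈ u · w - v · w
  ·-distrib-- u v w = trans (·-distrib-+ u (λ i → - v i) w) (+-congˡ (·-neg v w))

  ·-distrib--ʳ : ∀ {n} (u v w : Vector n) → u · (λ i → v i - w i) ≈ u · v - u · w
  ·-distrib--ʳ u v w = trans (·-comm u _) (trans (·-distrib-- v w u) (+-cong (·-comm v u) (-‿cong (·-comm w u))))

  ·-*ʳ : ∀ {n} (u v : Vector n) a → u · (λ i → v i * a) ≈ (u · v) * a
  ·-*ʳ u v a = trans (sum-cong (λ i → sym (*-assoc (u i) (v i) a))) (sym (*-distribʳ-sum a (λ i → u i * v i)))

  δ-· : ∀ {n} (i : Fin n) (v : Vector n) → δ i · v ≈ v i
  δ-· i v = trans (sum-point i (λ j → δ i j * v j) off) (trans (*-congʳ (δ-same)) (*-identityˡ (v i)))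
    where
    off : ∀ j → j ≢ i → δ i j * v j ≈ 0#
    off j j≢i with i ≟ j
    ... | yes i≡j = ⊥-elim (j≢i (≡.sym i≡j))
    ... | no  _   = zeroˡ (v j)
    δ-same : δ i i ≈ 1#
    δ-same with i ≟ i
    ... | yes _   = refl
    ... | no  i≢i = ⊥-elim (i≢i ≡.refl)

  bilinear-form : ∀ {m n} (u : Vector m) (B : Matrix m n) (v : Vector n) →
    sum (λ i → sum (λ j → (u i * B i j) * v j)) ≈ u · (B ▹ v)
  bilinear-form u B v = sum-cong λ i → begin
    sum (λ j → (u i * B i j) * v j) ≈⟨ sum-cong (λ j → *-assoc (u i) (B i j) (v j)) ⟩
    sum (λ j → u i * (B i j * v j)) ≈⟨ *-distribˡ-sum (u i) (λ j → B i j * v j) ⟨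
    u i * (B ▹ v) i                 ∎

  ∑R-bilinear-form : ∀ {m n} (u : Vector m) (B : Matrix m n) (v : Vector n) →
    ∑R R (λ i → ∑R R (λ j → (u i * B i j) * v j)) ≈ u · (B ▹ v)
  ∑R-bilinear-form u B v = trans (∑R-double (λ i j → (u i * B i j) * v j)) (bilinear-form u B v)

  ◃-· : ∀ {m n} (u : Vector m) (A : Matrix m n) (v : Vector n) → (u ◃ A) · v ≈ u · (A ▹ v)
  ◃-· u A v = begin
    sum (λ j → (u ◃ A) j * v j)                 ≈⟨ sum-cong (λ j → *-distribʳ-sum (v j) (λ i → u i * A i j)) ⟩
    sum (λ j → sum (λ i → (u i * A i j) * v j)) ≈⟨ ∑-comm (λ j i → (u i * A i j) * v j) ⟩
    sum (λ i → sum (λ j → (u i * A i j) * v j)) ≈⟨ bilinear-form u A v ⟩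
    u · (A ▹ v)                                 ∎

  ▹-symmetric : ∀ {n} {Q : Matrix n n} → Symmetric Q → ∀ (u : Vector n) i → (Q ▹ u) i ≈ (u ◃ Q) i
  ▹-symmetric {Q = Q} Q-sym u i = trans (·-comm (Q i) u) (·-congˡ u (Q-sym i))

  self-adjoint : ∀ {n} {Q : Matrix n n} → Symmetric Q → ∀ (u v : Vector n) → (Q ▹ u) · v ≈ u · (Q ▹ v)
  self-adjoint {Q = Q} Q-sym u v = begin
    (Q ▹ u) · v ≈⟨ ·-cong (▹-symmetric Q-sym u) (λ _ → refl) ⟩
    (u ◃ Q) · v ≈⟨ ◃-· u Q v ⟩
    u · (Q ▹ v) ∎

  GeneralizedInverse : ∀ {n} → Matrix n n → Matrix n n → Set ℓ
  GeneralizedInverse Q L = ∀ i j → sum (λ k → sum (λ l → (Q i k * L k l) * Q l j)) ≈ Q i j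

  generalized-inverse-∑R : ∀ {n} {Q L : Matrix n n} →
    (∀ i j → ∑R R (λ k → ∑R R (λ l → (Q i k * L k l) * Q l j)) ≈ Q i j) → GeneralizedInverse Q L
  generalized-inverse-∑R {Q = Q} {L} QLQ≈Q i j = trans (sym (∑R-double (λ k l → (Q i k * L k l) * Q l j))) (QLQ≈Q i j)

  generalized-inverse-▹ : ∀ {n} {Q L : Matrix n n} → GeneralizedInverse Q L →
    ∀ (v : Vector n) i → (Q ▹ L ▹ Q ▹ v) i ≈ (Q ▹ v) i
  generalized-inverse-▹ {Q = Q} {L} QLQ≈Q v i = begin
    Q i · (L ▹ Q ▹ v)   ≈⟨ ◃-· (Q i) L (Q ▹ v) ⟨
    (Q i ◃ L) · (Q ▹ v) ≈⟨ ◃-· (Q i ◃ L) Q v ⟨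
    (Q i ◃ L ◃ Q) · v   ≈⟨ ·-cong row (λ _ → refl) ⟩
    Q i · v             ∎
    where
    row : ∀ j → (Q i ◃ L ◃ Q) j ≈ Q i j
    row j = begin
      (Q i ◃ L) · (λ l → Q l j)                       ≈⟨ ◃-· (Q i) L (λ l → Q l j) ⟩
      Q i · (L ▹ (λ l → Q l j))                       ≈⟨ bilinear-form (Q i) L (λ l → Q l j) ⟨
      sum (λ k → sum (λ l → (Q i k * L k l) * Q l j)) ≈⟨ QLQ≈Q i j ⟩
      Q i j                                           ∎

  pairing-identity : ∀ {n} {Q L : Matrix n n} → Symmetric Q → GeneralizedInverse Q L →
    ∀ (d₁ d₂ h f : Vector n) (M N : Carrier) → N * M ≈ 1# →
    (∀ i → d₁ i ≈ (Q ▹ h) i) → (∀ j → M * d₂ j ≈ (Q ▹ f) j) →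
    d₁ · (L ▹ d₂) ≈ N * (d₁ · f)
  pairing-identity {Q = Q} {L} Q-sym QLQ≈Q d₁ d₂ h f M N NM≈1 d₁≈Qh Md₂≈Qf = begin
    d₁ · (L ▹ d₂)                     ≈⟨ ·-congˡ d₁ (λ k → ·-congˡ (L k) d₂≈NQf) ⟩
    d₁ · (L ▹ (λ j → N * (Q ▹ f) j)) ≈⟨ ·-congˡ d₁ (λ k → ·-scaleʳ N (L k) (Q ▹ f)) ⟩
    d₁ · (λ k → N * (L ▹ Q ▹ f) k)   ≈⟨ ·-scaleʳ N d₁ (L ▹ Q ▹ f) ⟩
    N * (d₁ · (L ▹ Q ▹ f))           ≈⟨ *-congˡ (·-cong d₁≈Qh (λ _ → refl)) ⟩
    N * ((Q ▹ h) · (L ▹ Q ▹ f))      ≈⟨ *-congˡ (self-adjoint Q-sym h (L ▹ Q ▹ f)) ⟩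
    N * (h · (Q ▹ L ▹ Q ▹ f))        ≈⟨ *-congˡ (·-congˡ h (generalized-inverse-▹ QLQ≈Q f)) ⟩
    N * (h · (Q ▹ f))                ≈⟨ *-congˡ (self-adjoint Q-sym h f) ⟨
    N * ((Q ▹ h) · f)                ≈⟨ *-congˡ (·-cong d₁≈Qh (λ _ → refl)) ⟨
    N * (d₁ · f)                     ∎
    where
    d₂≈NQf : ∀ j → d₂ j ≈ N * (Q ▹ f) j
    d₂≈NQf j = begin
      d₂ j           ≈⟨ *-identityˡ (d₂ j) ⟨
      1# * d₂ j      ≈⟨ *-congʳ NM≈1 ⟨
      N * M * d₂ j   ≈⟨ *-assoc N M (d₂ j) ⟩
      N * (M * d₂ j) ≈⟨ *-congˡ (Md₂≈Qf j) ⟩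
      N * (Q ▹ f) j  ∎

  constant-· : ∀ {n} (y b : Vector n) → (∀ i j → y i ≈ y j) → sum b ≈ 0# → y · b ≈ 0#
  constant-· {zero}  y b _       _      = refl
  constant-· {suc n} y b y-const sum≈0 = begin
    y · b                  ≈⟨ ·-cong {v = b} (λ i → y-const i zero) (λ _ → refl) ⟩
    (λ _ → y zero) · b     ≈⟨ *-distribˡ-sum (y zero) b ⟨
    y zero * sum b         ≈⟨ *-congˡ sum≈0 ⟩
    y zero * 0#            ≈⟨ zeroʳ (y zero) ⟩
    0#                     ∎


module IntegersInRationals where
  open ≡ using (refl; sym; trans; cong; cong₂)

  ι : ℤ → ℚ
  ι a = a ℚ./ 1

  fromℚᵘ-+ : ∀ p q → fromℚᵘ (p ℚᵘ.+ q) ≡ fromℚᵘ p ℚ.+ fromℚᵘ q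
  fromℚᵘ-+ p q = ℚP.toℚᵘ-injective (ℚᵘP.≃-trans (ℚP.toℚᵘ-fromℚᵘ (p ℚᵘ.+ q)) (ℚᵘP.≃-sym
    (ℚᵘP.≃-trans (ℚP.toℚᵘ-homo-+ (fromℚᵘ p) (fromℚᵘ q)) (ℚᵘP.+-cong (ℚP.toℚᵘ-fromℚᵘ p) (ℚP.toℚᵘ-fromℚᵘ q)))))

  fromℚᵘ-* : ∀ p q → fromℚᵘ (p ℚᵘ.* q) ≡ fromℚᵘ p ℚ.* fromℚᵘ q
  fromℚᵘ-* p q = ℚP.toℚᵘ-injective (ℚᵘP.≃-trans (ℚP.toℚᵘ-fromℚᵘ (p ℚᵘ.* q)) (ℚᵘP.≃-sym
    (ℚᵘP.≃-trans (ℚP.toℚᵘ-homo-* (fromℚᵘ p) (fromℚᵘ q)) (ℚᵘP.*-cong (ℚP.toℚᵘ-fromℚᵘ p) (ℚP.toℚᵘ-fromℚᵘ q)))))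

  fromℚᵘ-neg : ∀ p → fromℚᵘ (ℚᵘ.- p) ≡ ℚ.- fromℚᵘ p
  fromℚᵘ-neg p = ℚP.toℚᵘ-injective (ℚᵘP.≃-trans (ℚP.toℚᵘ-fromℚᵘ (ℚᵘ.- p)) (ℚᵘP.≃-sym
    (ℚᵘP.≃-trans (ℚP.toℚᵘ-homo‿- (fromℚᵘ p)) (ℚᵘP.-‿cong (ℚP.toℚᵘ-fromℚᵘ p)))))

  ι-+ : ∀ a b → ι (a ℤ.+ b) ≡ ι a ℚ.+ ι b
  ι-+ a b = trans (cong (λ z → fromℚᵘ (mkℚᵘ z 0)) (cong₂ ℤ._+_ (sym (ℤP.*-identityʳ a)) (sym (ℤP.*-identityʳ b))))
                  (fromℚᵘ-+ (mkℚᵘ a 0) (mkℚᵘ b 0))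

  ι-* : ∀ a b → ι (a ℤ.* b) ≡ ι a ℚ.* ι b
  ι-* a b = fromℚᵘ-* (mkℚᵘ a 0) (mkℚᵘ b 0)

  ι-neg : ∀ a → ι (ℤ.- a) ≡ ℚ.- ι a
  ι-neg a = fromℚᵘ-neg (mkℚᵘ a 0)

  ι-injective : ∀ {a b} → ι a ≡ ι b → a ≡ b
  ι-injective {a} {b} ιa≡ιb with ℚP.fromℚᵘ-injective {mkℚᵘ a 0} {mkℚᵘ b 0} ιa≡ιb
  ... | *≡* a1≡b1 = trans (sym (ℤP.*-identityʳ a)) (trans a1≡b1 (ℤP.*-identityʳ b))

  cancel : ∀ {a} a′ m k → a′ ℤ.* m ≡ a ℤ.* + suc k → fromℚᵘ (mkℚᵘ a′ k) ℚ.* ι m ≡ ι a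
  cancel {a} a′ m k a′m≡ak = trans (sym (fromℚᵘ-* (mkℚᵘ a′ k) (mkℚᵘ m 0))) (ℚP.fromℚᵘ-cong {mkℚᵘ a′ k ℚᵘ.* mkℚᵘ m 0} {mkℚᵘ a 0} (*≡* cross))
    where
    cross : (a′ ℤ.* m) ℤ.* + 1 ≡ a ℤ.* + (suc k ℕ.* 1)
    cross = trans (ℤP.*-identityʳ _) (trans a′m≡ak (cong (λ d → a ℤ.* + d) (sym (ℕP.*-identityʳ (suc k)))))

  /ℤ-cancel : ∀ a m → m ≢ 0ℤ → (a /ℤ m) ℚ.* ι m ≡ ι a
  /ℤ-cancel a (+ zero)    m≢0 = ⊥-elim (m≢0 refl)
  /ℤ-cancel a (+ suc k)   _   = cancel {a} a (+ suc k) k refl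
  /ℤ-cancel a -[1+ k ]    _   = cancel {a} (ℤ.- a) -[1+ k ] k neg-neg
    where
    neg-neg : (ℤ.- a) ℤ.* (ℤ.- (+ suc k)) ≡ a ℤ.* + suc k
    neg-neg = trans (sym (ℤP.neg-distribˡ-* a _)) (trans (cong ℤ.-_ (sym (ℤP.neg-distribʳ-* a _))) (ℤP.neg-involutive _))


module LaplacianEntries {n} (G : Multigraph n) where
  open ≡ using (refl; sym; trans; cong)

  laplacian-diag : ∀ v → laplacian G v v ≡ degree G v
  laplacian-diag v with v ≟ v
  ... | yes _   = refl
  ... | no  v≢v = ⊥-elim (v≢v refl)

  laplacian-off : ∀ v w → v ≢ w → laplacian G v w ≡ ℤ.- (+ mult G v w)
  laplacian-off v w v≢w with v ≟ w
  ... | yes v≡w = ⊥-elim (v≢w v≡w)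
  ... | no  _   = refl

  laplacian-sym : ∀ v w → laplacian G v w ≡ laplacian G w v
  laplacian-sym v w with v ≟ w
  ... | yes refl = sym (laplacian-diag v)
  ... | no  v≢w  = trans (cong (λ k → ℤ.- (+ k)) (symmetric G v w)) (sym (laplacian-off w v (λ w≡v → v≢w (sym w≡v))))


-- The Laplacian read in a commutative ring R through an additive map ψ : ℤ → R.
-- Its action on a vector is the formula defining div:
-- (Q y)(v) = Σ_w mult(v,w) · (y v − y w).
module LaplacianAction {c ℓ} (R : CommutativeRing c ℓ) (ψ : ℤ → CommutativeRing.Carrier R)
  (ψ-+ : ∀ a b → CommutativeRing._≈_ R (ψ (a ℤ.+ b)) (CommutativeRing._+_ R (ψ a) (ψ b)))
  (ψ-neg : ∀ a → CommutativeRing._≈_ R (ψ (ℤ.- a)) (CommutativeRing.-_ R (ψ a)))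
  (ψ-0 : CommutativeRing._≈_ R (ψ 0ℤ) (CommutativeRing.0# R)) where
  open CommutativeRing R hiding (zero)
  open LinearAlgebra R
  open import Algebra.Properties.Group +-group using (//-rightDividesʳ)
  open import Algebra.Properties.Ring ring using (-‿distribʳ-*)
  open import Relation.Binary.Reasoning.Setoid setoid

  ψ-sum : ∀ {n} (f : Fin n → ℤ) → ψ (∑ℤ f) ≈ sum (λ i → ψ (f i))
  ψ-sum {zero}  f = ψ-0
  ψ-sum {suc n} f = trans (ψ-+ (f zero) _) (+-congˡ (ψ-sum (λ i → f (suc i))))

  Lap : ∀ {n} → Multigraph n → Matrix n n
  Lap G i j = ψ (laplacian G i j)

  Lap-symmetric : ∀ {n} (G : Multigraph n) → Symmetric (Lap G)
  Lap-symmetric G i j = reflexive (≡.cong ψ (LaplacianEntries.laplacian-sym G i j))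

  laplacian-action : ∀ {n} (G : Multigraph n) v (y : Vector n) →
    (Lap G ▹ y) v ≈ sum (λ w → ψ (+ mult G v w) * (y v - y w))
  laplacian-action G v y = begin
    (Lap G ▹ y) v                 ≈⟨ //-rightDividesʳ (a · y) ((Lap G ▹ y) v) ⟨
    (Lap G ▹ y) v + a · y - a · y ≈⟨ +-congʳ row+a·y ⟩
    sum a * y v - a · y           ≈⟨ +-cong (*-distribʳ-sum (y v) a) (sym (sum-neg (λ w → a w * y w))) ⟩
    sum (λ w → a w * y v) + sum (λ w → - (a w * y w))   ≈⟨ ∑-distrib-+ (λ w → a w * y v) (λ w → - (a w * y w)) ⟨
    sum (λ w → a w * y v + - (a w * y w))               ≈⟨ sum-cong (λ w → trans (+-congˡ (-‿distribʳ-* (a w) (y w))) (sym (distribˡ (a w) (y v) (- y w)))) ⟩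
    sum (λ w → a w * (y v - y w)) ∎
    where
    open LaplacianEntries G
    a : Vector _
    a w = ψ (+ mult G v w)
    row+a·y : (Lap G ▹ y) v + a · y ≈ sum a * y v
    row+a·y = begin
      (Lap G ▹ y) v + a · y                       ≈⟨ ∑-distrib-+ (λ w → Lap G v w * y w) (λ w → a w * y w) ⟨
      sum (λ w → Lap G v w * y w + a w * y w)     ≈⟨ sum-point v (λ w → Lap G v w * y w + a w * y w) off-diagonal ⟩
      Lap G v v * y v + a v * y v                 ≈⟨ +-cong (*-congʳ (trans (reflexive (≡.cong ψ (laplacian-diag v))) (ψ-sum (λ w → + mult G v w))))
                                                            (*-congʳ (trans (reflexive (≡.cong (λ k → ψ (+ k)) (loopless G v))) ψ-0)) ⟩
      sum a * y v + 0# * y v                      ≈⟨ +-congˡ (zeroˡ (y v)) ⟩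
      sum a * y v + 0#                            ≈⟨ +-identityʳ _ ⟩
      sum a * y v                                 ∎
      where
      off-diagonal : ∀ w → w ≢ v → Lap G v w * y w + a w * y w ≈ 0#
      off-diagonal w w≢v = begin
        Lap G v w * y w + a w * y w   ≈⟨ +-congʳ (*-congʳ (trans (reflexive (≡.cong ψ (laplacian-off v w (λ v≡w → w≢v (≡.sym v≡w))))) (ψ-neg _))) ⟩
        - a w * y w + a w * y w       ≈⟨ distribʳ (y w) (- a w) (a w) ⟨
        (- a w + a w) * y w           ≈⟨ *-congʳ (-‿inverseˡ (a w)) ⟩
        0# * y w                      ≈⟨ zeroˡ (y w) ⟩
        0#                            ∎


-- Gaussian elimination over ℚ, in the form of the Fredholm alternative:
-- either Ax = b has a solution, or some y has yᵀA = 0 but y·b ≠ 0.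
module GaussianElimination where
  open LinearAlgebra ℚP.+-*-commutativeRing
  open Data.Rational using (_+_; _*_; _-_; 1/_)
  open ≡ using (refl; sym; trans; cong)
  open ≡.≡-Reasoning
  open import Data.Rational.Solver using (module +-*-Solver)
  open +-*-Solver

  Solvable : ∀ {m n} → Matrix m n → Vector m → Set
  Solvable A b = ∃ λ x → ∀ i → (A ▹ x) i ≡ b i

  Obstructed : ∀ {m n} → Matrix m n → Vector m → Set
  Obstructed A b = ∃ λ y → (∀ j → (y ◃ A) j ≡ 0ℚ) × y · b ≢ 0ℚ

  all-or-counterexample : ∀ {m p} {P : Fin m → Set p} → Decidable P → (∀ i → P i) ⊎ ∃ (λ i → ¬ P i)
  all-or-counterexample {m} {P = P} P? with all? P?
  ... | yes ∀P = inj₁ ∀P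
  ... | no ¬∀P = inj₂ (¬∀⟶∃¬ m P P? ¬∀P)

  module ZeroColumn {m n} (A : Matrix m (suc n)) (b : Vector m) (col≡0 : ∀ i → A i zero ≡ 0ℚ) where
    A′ : Matrix m n
    A′ i j = A i (suc j)

    lift-solution : Solvable A′ b → Solvable A b
    lift-solution (x′ , A′x′≡b) = x , λ i → begin
      A i zero * 0ℚ + (A′ ▹ x′) i ≡⟨ cong (_+ (A′ ▹ x′) i) (ℚP.*-zeroʳ (A i zero)) ⟩
      0ℚ + (A′ ▹ x′) i             ≡⟨ ℚP.+-identityˡ _ ⟩
      (A′ ▹ x′) i                  ≡⟨ A′x′≡b i ⟩
      b i                          ∎
      where
      x : Vector (suc n)
      x zero    = 0ℚ
      x (suc j) = x′ j

    lift-obstruction : Obstructed A′ b → Obstructed A b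
    lift-obstruction (y , yA′≡0 , y·b≢0) = y , yA≡0 , y·b≢0
      where
      yA≡0 : ∀ j → (y ◃ A) j ≡ 0ℚ
      yA≡0 zero    = trans (·-congˡ y col≡0) (trans (sum-cong (λ i → ℚP.*-zeroʳ (y i))) (sum-replicate-zero m))
      yA≡0 (suc j) = yA′≡0 j

  -- Eliminating the first column with the pivot A r 0 ≠ 0: row i is replaced
  -- by row i − c i · row r, which clears its first entry.
  module Pivot {m n} (A : Matrix m (suc n)) (b : Vector m) (r : Fin m) (p≢0 : A r zero ≢ 0ℚ) where
    p⁻¹ : ℚ
    p⁻¹ = (1/ A r zero) {{ℚ.≢-nonZero p≢0}}

    c : Vector m
    c i = A i zero * p⁻¹

    A′ : Matrix m n
    A′ i j = A i (suc j) - c i * A r (suc j)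

    b′ : Vector m
    b′ i = b i - c i * b r

    lift-solution : Solvable A′ b′ → Solvable A b
    lift-solution (x′ , A′x′≡b′) = x , λ i → begin
      A i zero * x zero + s i        ≡⟨ solve 5 (λ a q br sr si → a :* ((br :- sr) :* q) :+ si := (si :- a :* q :* sr) :+ a :* q :* br)
                                              refl (A i zero) p⁻¹ (b r) (s r) (s i) ⟩
      (s i - c i * s r) + c i * b r  ≡⟨ cong (_+ c i * b r) (trans (sym (row-op i)) (A′x′≡b′ i)) ⟩
      (b i - c i * b r) + c i * b r  ≡⟨ solve 2 (λ bi t → (bi :- t) :+ t := bi) refl (b i) (c i * b r) ⟩
      b i                            ∎
      where
      s : Vector m
      s i = (λ j → A i (suc j)) · x′

      row-op : ∀ i → (A′ ▹ x′) i ≡ s i - c i * s r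
      row-op i = trans (·-distrib-- (λ j → A i (suc j)) (λ j → c i * A r (suc j)) x′)
                       (cong (λ t → s i - t) (·-scaleˡ (c i) (λ j → A r (suc j)) x′))

      x : Vector (suc n)
      x zero    = (b r - s r) * p⁻¹
      x (suc j) = x′ j

    lift-obstruction : Obstructed A′ b′ → Obstructed A b
    lift-obstruction (y′ , y′A′≡0 , y′·b′≢0) = y , yA≡0 , y·b≢0
      where
      K : ℚ
      K = y′ · c

      y : Vector m
      y i = y′ i - K * δ r i

      y· : ∀ z → y · z ≡ y′ · z - K * z r
      y· z = trans (·-distrib-- y′ (λ i → K * δ r i) z) (cong (λ t → y′ · z - t) (trans (·-scaleˡ K (δ r) z) (cong (K *_) (δ-· r z))))

      y′·row-op : ∀ (u : Vector m) w → y′ · (λ i → u i - c i * w) ≡ y′ · u - K * w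
      y′·row-op u w = trans (·-distrib--ʳ y′ u (λ i → c i * w)) (cong (λ t → y′ · u - t) (·-*ʳ y′ c w))

      c·p : ∀ i → A i zero ≡ c i * A r zero
      c·p i = sym (trans (ℚP.*-assoc (A i zero) p⁻¹ (A r zero))
                  (trans (cong (A i zero *_) (ℚP.*-inverseˡ (A r zero) {{ℚ.≢-nonZero p≢0}})) (ℚP.*-identityʳ (A i zero))))

      yA≡0 : ∀ j → (y ◃ A) j ≡ 0ℚ
      yA≡0 zero = begin
        y · (λ i → A i zero)                        ≡⟨ y· (λ i → A i zero) ⟩
        y′ · (λ i → A i zero) - K * A r zero        ≡⟨ cong (_- K * A r zero) (trans (·-congˡ y′ c·p) (·-*ʳ y′ c (A r zero))) ⟩
        K * A r zero - K * A r zero                 ≡⟨ ℚP.+-inverseʳ (K * A r zero) ⟩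
        0ℚ                                          ∎
      yA≡0 (suc j) = begin
        y · (λ i → A i (suc j))                     ≡⟨ y· (λ i → A i (suc j)) ⟩
        y′ · (λ i → A i (suc j)) - K * A r (suc j)  ≡⟨ y′·row-op (λ i → A i (suc j)) (A r (suc j)) ⟨
        (y′ ◃ A′) j                                 ≡⟨ y′A′≡0 j ⟩
        0ℚ                                          ∎

      y·b≢0 : y · b ≢ 0ℚ
      y·b≢0 y·b≡0 = y′·b′≢0 (trans (y′·row-op b (b r)) (trans (sym (y· b)) y·b≡0))

  fredholm : ∀ {m} n (A : Matrix m n) (b : Vector m) → Solvable A b ⊎ Obstructed A b
  fredholm zero A b with all-or-counterexample (λ i → b i ℚP.≟ 0ℚ)
  ... | inj₁ b≡0        = inj₁ ((λ ()) , λ i → sym (b≡0 i))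
  ... | inj₂ (i , bi≢0) = inj₂ (δ i , (λ ()) , λ δi·b≡0 → bi≢0 (trans (sym (δ-· i b)) δi·b≡0))
  fredholm (suc n) A b with all-or-counterexample (λ i → A i zero ℚP.≟ 0ℚ)
  ... | inj₁ col≡0     = Sum.map lift-solution lift-obstruction (fredholm n A′ b)
    where open ZeroColumn A b col≡0
  ... | inj₂ (r , p≢0) = Sum.map lift-solution lift-obstruction (fredholm n A′ b′)
    where open Pivot A b r p≢0


module RationalPositivity where
  open LinearAlgebra ℚP.+-*-commutativeRing using (Vector; sum)
  open Data.Rational using (_+_; _*_; _≤_; 1/_; 1ℚ)
  open ≡ using (sym; trans; cong; subst)

  square-nonneg : ∀ x → 0ℚ ≤ x * x
  square-nonneg x with ℚP.≤-total 0ℚ x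
  ... | inj₁ 0≤x = ℚP.nonNegative⁻¹ (x * x) {{ℚP.nonNeg*nonNeg⇒nonNeg x {{ℚ.nonNegative 0≤x}} x {{ℚ.nonNegative 0≤x}}}}
  ... | inj₂ x≤0 = ℚP.nonNegative⁻¹ (x * x) {{ℚP.nonPos*nonPos⇒nonPos x {{ℚ.nonPositive x≤0}} x {{ℚ.nonPositive x≤0}}}}

  *-nonneg : ∀ {x y} → 0ℚ ≤ x → 0ℚ ≤ y → 0ℚ ≤ x * y
  *-nonneg {x} {y} 0≤x 0≤y = ℚP.nonNegative⁻¹ (x * y) {{ℚP.nonNeg*nonNeg⇒nonNeg x {{ℚ.nonNegative 0≤x}} y {{ℚ.nonNegative 0≤y}}}}

  sum-nonneg : ∀ {n} (f : Vector n) → (∀ i → 0ℚ ≤ f i) → 0ℚ ≤ sum f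
  sum-nonneg {zero}  f _      = ℚP.≤-refl
  sum-nonneg {suc n} f 0≤f = ℚP.+-mono-≤ (0≤f zero) (sum-nonneg (λ i → f (suc i)) (λ i → 0≤f (suc i)))

  sum-nonneg-zero : ∀ {n} (f : Vector n) → (∀ i → 0ℚ ≤ f i) → sum f ≡ 0ℚ → ∀ i → f i ≡ 0ℚ
  sum-nonneg-zero {suc n} f 0≤f sum≡0 = λ { zero → head≡0 ; (suc i) → sum-nonneg-zero (λ i → f (suc i)) (λ i → 0≤f (suc i)) tail≡0 i }
    where
    tail-nonneg : 0ℚ ≤ sum (λ i → f (suc i))
    tail-nonneg = sum-nonneg (λ i → f (suc i)) (λ i → 0≤f (suc i))
    head≡0 : f zero ≡ 0ℚ
    head≡0 = ℚP.≤-antisym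
      (subst (f zero ≤_) sum≡0 (subst (_≤ sum f) (ℚP.+-identityʳ (f zero)) (ℚP.+-monoʳ-≤ (f zero) tail-nonneg)))
      (0≤f zero)
    tail≡0 : sum (λ i → f (suc i)) ≡ 0ℚ
    tail≡0 = trans (sym (ℚP.+-identityˡ _)) (trans (cong (_+ sum (λ i → f (suc i))) (sym head≡0)) sum≡0)

  *-cancel-zero : ∀ {x y} → x ≢ 0ℚ → x * y ≡ 0ℚ → y ≡ 0ℚ
  *-cancel-zero {x} {y} x≢0 xy≡0 = begin
    y              ≡⟨ ℚP.*-identityˡ y ⟨
    1ℚ * y         ≡⟨ cong (_* y) (ℚP.*-inverseˡ x) ⟨
    x⁻¹ * x * y    ≡⟨ ℚP.*-assoc x⁻¹ x y ⟩
    x⁻¹ * (x * y)  ≡⟨ cong (x⁻¹ *_) xy≡0 ⟩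
    x⁻¹ * 0ℚ       ≡⟨ ℚP.*-zeroʳ x⁻¹ ⟩
    0ℚ             ∎
    where
    open ≡.≡-Reasoning
    instance
      x-nonZero : ℚ.NonZero x
      x-nonZero = ℚ.≢-nonZero x≢0
    x⁻¹ : ℚ
    x⁻¹ = 1/ x

  square-zero : ∀ x → x * x ≡ 0ℚ → x ≡ 0ℚ
  square-zero x xx≡0 with x ℚP.≟ 0ℚ
  ... | yes x≡0 = x≡0
  ... | no  x≢0 = *-cancel-zero x≢0 xx≡0


-- Over ℚ, a vector killed by the Laplacian of a connected multigraph is
-- constant: the energy Σ_v Σ_w mult(v,w) (y v − y w)² equals 2 yᵀQy = 0, and a
-- vanishing sum of nonnegative terms forces y v = y w along every edge.
module LaplacianKernel {n} (G : Multigraph n) where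
  open IntegersInRationals
  open LinearAlgebra ℚP.+-*-commutativeRing
  open LaplacianAction ℚP.+-*-commutativeRing ι ι-+ ι-neg ≡.refl
  open RationalPositivity
  open Data.Rational using (_+_; _*_; _-_; _≤_)
  open ≡ using (refl; sym; trans; cong; cong₂)
  open ≡.≡-Reasoning
  open import Data.Rational.Solver using (module +-*-Solver)
  open +-*-Solver

  a : Matrix n n
  a v w = ι (+ mult G v w)

  module _ (y : Vector n) (Qy≡0 : ∀ v → (Lap G ▹ y) v ≡ 0ℚ) where

    -- summands of yᵀQy = Σ_v y v · Σ_w mult(v,w)(y v − y w), which vanishes
    t : Matrix n n
    t v w = a v w * (y v * (y v - y w))

    t-sum : sum (λ v → sum (λ w → t v w)) ≡ 0ℚ
    t-sum = trans (sum-cong row) (sum-replicate-zero n)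
      where
      row : ∀ v → sum (λ w → t v w) ≡ 0ℚ
      row v = begin
        sum (λ w → t v w)                           ≡⟨ sum-cong (λ w → solve 3 (λ av yv d → av :* (yv :* d) := yv :* (av :* d)) refl (a v w) (y v) (y v - y w)) ⟩
        sum (λ w → y v * (a v w * (y v - y w)))    ≡⟨ *-distribˡ-sum (y v) (λ w → a v w * (y v - y w)) ⟨
        y v * sum (λ w → a v w * (y v - y w))      ≡⟨ cong (y v *_) (trans (sym (laplacian-action G v y)) (Qy≡0 v)) ⟩
        y v * 0ℚ                                   ≡⟨ ℚP.*-zeroʳ (y v) ⟩
        0ℚ                                         ∎

    -- summands of the Dirichlet energy; their sum is t summed both ways
    energy : Matrix n n
    energy v w = a v w * ((y v - y w) * (y v - y w))

    energy-sum : sum (λ v → sum (λ w → energy v w)) ≡ 0ℚ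
    energy-sum = begin
      sum (λ v → sum (λ w → energy v w))                     ≡⟨ sum-cong (λ v → trans (sum-cong (split v)) (∑-distrib-+ (t v) (λ w → t w v))) ⟩
      sum (λ v → sum (λ w → t v w) + sum (λ w → t w v))      ≡⟨ ∑-distrib-+ (λ v → sum (t v)) (λ v → sum (λ w → t w v)) ⟩
      sum (λ v → sum (λ w → t v w)) + sum (λ v → sum (λ w → t w v)) ≡⟨ cong₂ _+_ t-sum (trans (∑-comm (λ v w → t w v)) t-sum) ⟩
      0ℚ + 0ℚ                                                ≡⟨⟩
      0ℚ                                                     ∎
      where
      split : ∀ v w → energy v w ≡ t v w + t w v
      split v w = trans (solve 3 (λ c yv yw → c :* ((yv :- yw) :* (yv :- yw)) := c :* (yv :* (yv :- yw)) :+ c :* (yw :* (yw :- yv))) refl (a v w) (y v) (y w))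
                        (cong (λ c → t v w + c * (y w * (y w - y v))) (cong (λ k → ι (+ k)) (symmetric G v w)))

    energy-nonneg : ∀ v w → 0ℚ ≤ energy v w
    energy-nonneg v w = *-nonneg (ℚP.nonNegative⁻¹ (a v w) {{ℚP.normalize-nonNeg (mult G v w) 1}}) (square-nonneg (y v - y w))

    neighbours-agree : ∀ v w → ℕ.NonZero (mult G v w) → y v ≡ y w
    neighbours-agree v w mult≢0 = begin
      y v               ≡⟨ solve 2 (λ yv yw → yv := (yv :- yw) :+ yw) refl (y v) (y w) ⟩
      (y v - y w) + y w ≡⟨ cong (_+ y w) (square-zero (y v - y w) (*-cancel-zero a≢0 (energy-zero v w))) ⟩
      0ℚ + y w          ≡⟨ ℚP.+-identityˡ (y w) ⟩
      y w               ∎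
      where
      energy-zero : ∀ v w → energy v w ≡ 0ℚ
      energy-zero v = sum-nonneg-zero (energy v) (energy-nonneg v)
        (sum-nonneg-zero (λ v → sum (energy v)) (λ v → sum-nonneg (energy v) (energy-nonneg v)) energy-sum v)
      a≢0 : a v w ≢ 0ℚ
      a≢0 a≡0 = ℕ.≢-nonZero⁻¹ (mult G v w) {{mult≢0}} (ℤP.+-injective (ι-injective a≡0))

    kernel-constant : Connected G → ∀ v w → y v ≡ y w
    kernel-constant connected v w = along (connected v w)
      where
      along : ∀ {v w} → Reachable G v w → y v ≡ y w
      along here             = refl
      along (step mult≢0 vw) = trans (neighbours-agree _ _ mult≢0) (along vw)


-- Every degree-zero divisor on a connected multigraph lies in the rational
-- image of the Laplacian: otherwise the Fredholm alternative yields y with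
-- yᵀQ = 0, i.e. Qy = 0, so y is constant and y · D = 0 after all.
module RationalPreimage where
  open IntegersInRationals
  open LinearAlgebra ℚP.+-*-commutativeRing
  open LaplacianAction ℚP.+-*-commutativeRing ι ι-+ ι-neg ≡.refl
  open GaussianElimination using (fredholm)
  open ≡ using (sym; trans; cong)

  laplacian-preimage : ∀ {n} (G : Multigraph n) → Connected G → (D : Div n) → IsDiv0 D →
    ∃ λ (h : Vector n) → ∀ v → (Lap G ▹ h) v ≡ ι (D v)
  laplacian-preimage {n} G connected D deg≡0 with fredholm n (Lap G) (λ v → ι (D v))
  ... | inj₁ solvable               = solvable
  ... | inj₂ (y , yQ≡0 , y·D≢0) = ⊥-elim (y·D≢0 (constant-· y (λ v → ι (D v)) y-constant ∑D≡0))
    where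
    y-constant : ∀ v w → y v ≡ y w
    y-constant = LaplacianKernel.kernel-constant G y (λ v → trans (▹-symmetric (Lap-symmetric G) y v) (yQ≡0 v)) connected
    ∑D≡0 : sum (λ v → ι (D v)) ≡ 0ℚ
    ∑D≡0 = trans (sym (ψ-sum D)) (cong ι deg≡0)


module Transport {c ℓ} (R : CommutativeRing c ℓ) (φ : ℚ → CommutativeRing.Carrier R)
  (hom : IsRingHomomorphism ℚ.+-*-rawRing (CommutativeRing.rawRing R) φ) where
  open CommutativeRing R hiding (zero)
  open IsRingHomomorphism hom
  open IntegersInRationals
  open LinearAlgebra R
  module ℚ-LA = LinearAlgebra ℚP.+-*-commutativeRing
  module ℚ-Lap = LaplacianAction ℚP.+-*-commutativeRing ι ι-+ ι-neg ≡.refl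
  open import Relation.Binary.Reasoning.Setoid setoid

  ψ : ℤ → Carrier
  ψ a = φ (ι a)

  φ-≡ : ∀ {x y} → x ≡ y → φ x ≈ φ y
  φ-≡ x≡y = reflexive (≡.cong φ x≡y)

  ψ-+ : ∀ a b → ψ (a ℤ.+ b) ≈ ψ a + ψ b
  ψ-+ a b = trans (φ-≡ (ι-+ a b)) (+-homo (ι a) (ι b))

  ψ-* : ∀ a b → ψ (a ℤ.* b) ≈ ψ a * ψ b
  ψ-* a b = trans (φ-≡ (ι-* a b)) (*-homo (ι a) (ι b))

  ψ-neg : ∀ a → ψ (ℤ.- a) ≈ - ψ a
  ψ-neg a = trans (φ-≡ (ι-neg a)) (-‿homo (ι a))

  open LaplacianAction R ψ ψ-+ ψ-neg 0#-homo public using (Lap; Lap-symmetric; laplacian-action; ψ-sum)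

  φ-sum : ∀ {n} (g : Fin n → ℚ) → φ (ℚ-LA.sum g) ≈ sum (λ i → φ (g i))
  φ-sum {zero}  g = 0#-homo
  φ-sum {suc n} g = trans (+-homo (g zero) _) (+-congˡ (φ-sum (λ i → g (suc i))))

  module _ {n} (G : Multigraph n) where

    preimage-image : ∀ (D : Div n) (h : Fin n → ℚ) → (∀ v → (ℚ-Lap.Lap G ℚ-LA.▹ h) v ≡ ι (D v)) →
      ∀ v → ψ (D v) ≈ (Lap G ▹ (λ w → φ (h w))) v
    preimage-image D h Qh≡D v = begin
      ψ (D v)                                      ≈⟨ φ-≡ (Qh≡D v) ⟨
      φ ((ℚ-Lap.Lap G ℚ-LA.▹ h) v)                 ≈⟨ φ-sum (λ w → ι (laplacian G v w) ℚ.* h w) ⟩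
      sum (λ w → φ (ι (laplacian G v w) ℚ.* h w))  ≈⟨ sum-cong (λ w → *-homo _ (h w)) ⟩
      (Lap G ▹ (λ w → φ (h w))) v                  ∎

    divisor-in-image : Connected G → (D : Div n) → IsDiv0 D →
      ∃ λ (H : Vector n) → ∀ v → ψ (D v) ≈ (Lap G ▹ H) v
    divisor-in-image connected D deg≡0 with RationalPreimage.laplacian-preimage G connected D deg≡0
    ... | h , Qh≡D = (λ v → φ (h v)) , preimage-image D h Qh≡D

    principal-image : ∀ (D : Div n) m f → (m ·D D) ≡ divf G f →
      ∀ v → ψ m * ψ (D v) ≈ (Lap G ▹ (λ w → ψ (f w))) v
    principal-image D m f mD≡div-f v = begin
      ψ m * ψ (D v)                                         ≈⟨ ψ-* m (D v) ⟨
      ψ (m ℤ.* D v)                                         ≈⟨ reflexive (≡.cong ψ (≡.cong-app mD≡div-f v)) ⟩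
      ψ (divf G f v)                                        ≈⟨ ψ-sum (λ w → + mult G v w ℤ.* (f v ℤ.- f w)) ⟩
      sum (λ w → ψ (+ mult G v w ℤ.* (f v ℤ.- f w)))        ≈⟨ sum-cong (λ w → trans (ψ-* (+ mult G v w) (f v ℤ.- f w)) (*-congˡ (trans (ψ-+ (f v) (ℤ.- f w)) (+-congˡ (ψ-neg (f w)))))) ⟩
      sum (λ w → ψ (+ mult G v w) * (ψ (f v) - ψ (f w)))    ≈⟨ laplacian-action G v (λ w → ψ (f w)) ⟨
      (Lap G ▹ (λ w → ψ (f w))) v                           ∎

  module _ (m : ℤ) (m≢0 : m ≢ 0ℤ) where
    private instance
      ιm-nonZero : ℚ.NonZero (ι m)
      ιm-nonZero = ℚ.≢-nonZero (λ ιm≡0 → m≢0 (ι-injective ιm≡0))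

    m⁻¹ : Carrier
    m⁻¹ = φ (ℚ.1/ ι m)

    m⁻¹-inverse : m⁻¹ * ψ m ≈ 1#
    m⁻¹-inverse = trans (sym (*-homo _ _)) (trans (φ-≡ (ℚP.*-inverseˡ (ι m))) 1#-homo)

    pairingRep-image : ∀ {n} (D : Div n) f → φ (pairingRep D m f) ≈ m⁻¹ * ((λ v → ψ (D v)) · (λ v → ψ (f v)))
    pairingRep-image D f = begin
      φ (A /ℤ m)                 ≈⟨ φ-≡ quotient ⟩
      φ (ι A ℚ.* ℚ.1/ ι m)       ≈⟨ *-homo (ι A) _ ⟩
      ψ A * m⁻¹                  ≈⟨ *-comm (ψ A) m⁻¹ ⟩
      m⁻¹ * ψ A                  ≈⟨ *-congˡ (trans (ψ-sum (λ v → D v ℤ.* f v)) (sum-cong (λ v → ψ-* (D v) (f v)))) ⟩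
      m⁻¹ * ((λ v → ψ (D v)) · (λ v → ψ (f v))) ∎
      where
      A : ℤ
      A = ∑ℤ (λ v → D v ℤ.* f v)
      quotient : A /ℤ m ≡ ι A ℚ.* ℚ.1/ ι m
      quotient = ≡.trans (≡.sym (ℚP.*-identityʳ (A /ℤ m)))
        (≡.trans (≡.cong (A /ℤ m ℚ.*_) (≡.sym (ℚP.*-inverseʳ (ι m))))
        (≡.trans (≡.sym (ℚP.*-assoc (A /ℤ m) (ι m) (ℚ.1/ ι m))) (≡.cong (ℚ._* ℚ.1/ ι m) (/ℤ-cancel A m m≢0))))


proposition3p7 : ∀ {c ℓ : Level} (R : CommutativeRing c ℓ) (φ : ℚ → CommutativeRing.Carrier R)
  → IsRingHomomorphism ℚ.+-*-rawRing (CommutativeRing.rawRing R) φ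
  → ∀ {n : ℕ} (G : Multigraph n) → Connected G
  → (L : Fin n → Fin n → CommutativeRing.Carrier R)
  → (∀ i j → CommutativeRing._≈_ R
       (∑R R (λ k → ∑R R (λ l → CommutativeRing._*_ R (CommutativeRing._*_ R (φ (laplacian G i k ℚ./ 1)) (L k l)) (φ (laplacian G l j ℚ./ 1)))))
       (φ (laplacian G i j ℚ./ 1)))
  → (D₁ D₂ : Div n) → IsDiv0 D₁ → IsDiv0 D₂
  → (m₂ : ℤ) (f₂ : Fin n → ℤ) → m₂ ≢ 0ℤ → (m₂ ·D D₂) ≡ divf G f₂
  → ∃ λ (k : ℤ) → CommutativeRing._≈_ R
       (φ (pairingRep D₁ m₂ f₂))
       (CommutativeRing._+_ R
         (∑R R (λ i → ∑R R (λ j → CommutativeRing._*_ R (CommutativeRing._*_ R (φ (D₁ i ℚ./ 1)) (L i j)) (φ (D₂ j ℚ./ 1)))))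
         (φ (k ℚ./ 1)))
proposition3p7 R φ hom {n} G connected L QLQ≈Q D₁ D₂ deg₁≡0 _ m f m≢0 mD₂≡div-f = 0ℤ , (begin
  φ (pairingRep D₁ m f)                     ≈⟨ pairingRep-image m m≢0 D₁ f ⟩
  m⁻¹ m m≢0 * (d₁ · (λ v → ψ (f v)))        ≈⟨ pairing-identity (Lap-symmetric G) (generalized-inverse-∑R QLQ≈Q)
                                                 d₁ d₂ (proj₁ D₁-image) (λ v → ψ (f v)) (ψ m) (m⁻¹ m m≢0) (m⁻¹-inverse m m≢0)
                                                 (proj₂ D₁-image) (principal-image G D₂ m f mD₂≡div-f) ⟨
  d₁ · (L ▹ d₂)                             ≈⟨ ∑R-bilinear-form d₁ L d₂ ⟨
  T                                         ≈⟨ +-identityʳ T ⟨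
  T + 0#                                    ≈⟨ +-congˡ 0#-homo ⟨
  T + φ (0ℤ ℚ./ 1)                          ∎)
  where
  open CommutativeRing R hiding (zero)
  open IsRingHomomorphism hom using (0#-homo)
  open LinearAlgebra R
  open Transport R φ hom
  open Relation.Binary.Reasoning.Setoid setoid
  d₁ d₂ : Vector n
  d₁ v = ψ (D₁ v)
  d₂ v = ψ (D₂ v)
  D₁-image : ∃ λ (H : Vector n) → ∀ v → d₁ v ≈ (Lap G ▹ H) v
  D₁-image = divisor-in-image G connected D₁ deg₁≡0
  T : Carrier
  T = ∑R R (λ i → ∑R R (λ j → (d₁ i * L i j) * d₂ j))
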